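{- Let $m\geq 4$ be even and $d\equiv 3\pmod 6$. There exists a $(\mathbb Z_2^m\times\mathbb Z_d,\{2^{2^m-1},3^1\},3,1)$-difference family.
   Context: Let $(G,+)$ be a finite abelian group. A partial spread of $G$ is a family $\Sigma$ of subgroups of $G$ whose members pairwise intersect trivially; it has type $\{n_1^{f_1},\dots,n_t^{f_t}\}$ if it consists of exactly $f_i$ subgroups of order $n_i$ for each $i$ (and no others). For a triple $T=\{a,b,c\}$ of three distinct elements of $G$, $\Delta T$ is the multiset $\{\pm(a-b),\pm(a-c),\pm(b-c)\}$, and for a set $\mathcal T$ of triples, $\Delta\mathcal T$ is the multiset union of the $\Delta T$. For a partial spread $\Sigma$, a $(G,\Sigma,3,1)$-difference family is a set $\mathcal T$ of triples of $G$ with $\Delta\mathcal T=G\setminus\bigcup_{S\in\Sigma}S$ as multisets (each element outside the union occurs exactly once, elements of the union do not occur). A $(G,\tau,3,1)$-difference family is a $(G,\Sigma,3,1)$-difference family for some partial spread $\Sigma$ of $G$ of type $\tau$. -}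

module Defs where

open import Data.Nat using (ℕ; zero; suc; _+_; _∸_; NonZero)
open import Data.Nat.DivMod using (_mod_)
open import Data.Bool using (Bool; false; _xor_)
open import Data.Fin using (Fin; toℕ)
open import Data.Fin.Properties renaming (_≟_ to _≟F_)
open import Data.Bool.Properties renaming (_≟_ to _≟B_)
open import Data.Vec using (Vec; replicate; zipWith)
import Data.Vec.Properties as VP
import Data.Product.Properties as PP
open import Data.Product using (_×_; _,_; Σ; ∃)
open import Data.List using (List; []; _∷_; length; concatMap; filterᵇ; lookup)
open import Data.List.Membership.Propositional using (_∈_)
open import Data.List.Relation.Unary.Any using (Any)
open import Data.List.Relation.Unary.All using (All)
open import Data.List.Relation.Unary.Unique.Propositional using (Unique)
open import Data.Nat using (_≡ᵇ_)
open import Data.Sum using (_⊎_)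
open import Relation.Binary.PropositionalEquality using (_≡_; _≢_)
open import Relation.Binary.Definitions using (DecidableEquality)
open import Relation.Nullary using (¬_; yes; no)

module _ (m d : ℕ) .{{_ : NonZero d}} where

  G : Set
  G = Vec Bool m × Fin d

  0G : G
  0G = replicate m false , (0 mod d)

  _⊕_ : G → G → G
  (u , a) ⊕ (v , b) = zipWith _xor_ u v , ((toℕ a + toℕ b) mod d)

  ⊖_ : G → G
  ⊖ (u , a) = u , ((d ∸ toℕ a) mod d)

  _⊝_ : G → G → G
  x ⊝ y = x ⊕ (⊖ y)

  _≟G_ : DecidableEquality G
  _≟G_ = PP.≡-dec (VP.≡-dec _≟B_) _≟F_

  count : G → List G → ℕ
  count g [] = 0
  count g (x ∷ xs) with g ≟G x
  ... | yes _ = suc (count g xs)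
  ... | no  _ = count g xs

  record Subgroup : Set where
    field
      elems    : List G
      distinct : Unique elems
      has-0    : 0G ∈ elems
      closed-+ : ∀ {x y} → x ∈ elems → y ∈ elems → (x ⊕ y) ∈ elems
      closed-⁻ : ∀ {x} → x ∈ elems → (⊖ x) ∈ elems
  open Subgroup public

  order : Subgroup → ℕ
  order S = length (elems S)

  IsPartialSpread : List Subgroup → Set
  IsPartialSpread Σs = ∀ (i j : Fin (length Σs)) → i ≢ j →
    ∀ x → x ∈ elems (lookup Σs i) → x ∈ elems (lookup Σs j) → x ≡ 0G

  numOfOrder : ℕ → List Subgroup → ℕ
  numOfOrder n Σs = length (filterᵇ (λ S → order S ≡ᵇ n) Σs)

  HasType-2-3 : ℕ → List Subgroup → Set
  HasType-2-3 f Σs =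
    All (λ S → order S ≡ 2 ⊎ order S ≡ 3) Σs
    × numOfOrder 2 Σs ≡ f × numOfOrder 3 Σs ≡ 1

  Triple : Set
  Triple = G × G × G

  Distinct3 : Triple → Set
  Distinct3 (a , b , c) = a ≢ b × a ≢ c × b ≢ c

  ΔT : Triple → List G
  ΔT (a , b , c) = (a ⊝ b) ∷ (b ⊝ a) ∷ (a ⊝ c) ∷ (c ⊝ a) ∷ (b ⊝ c) ∷ (c ⊝ b) ∷ []

  Δ𝒯 : List Triple → List G
  Δ𝒯 = concatMap ΔT

  InUnion : List Subgroup → G → Set
  InUnion Σs g = Any (λ S → g ∈ elems S) Σs

  -- (G,Σ,3,1)-difference family: ΔT = G \ ∪Σ as multisets.
  IsDifferenceFamily : List Subgroup → List Triple → Set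
  IsDifferenceFamily Σs 𝒯 =
    All Distinct3 𝒯 ×
    (∀ g → (InUnion Σs g → count g (Δ𝒯 𝒯) ≡ 0)
         × (¬ InUnion Σs g → count g (Δ𝒯 𝒯) ≡ 1))

{-# OPTIONS --safe #-}
-- Write d = 6k + 3 = 3t = 2n + 1 and m = 2q.  The spread consists of the subgroups {0, (v, 0)}
-- for v ≠ 0 and {0, (0, t), (0, 2t)}; their union E has 2^m + 2 elements.  The base blocks are
-- triples {0, P, Q}, built by recursion on q: blocks for ℤ₂^m × ℤ_d are embedded under the
-- prefix 00, and the pairs P = (10u, x), Q = (01ωu, -x) for u ∈ ℤ₂^m, 1 ≤ x ≤ n, with ω
-- blockwise multiplication by a primitive element of GF(4), cover the three new rows because
-- P - Q = (11ω²u, 2x).  The recursion starts at m = 0 when d = 3 and from explicit blocks at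
-- m = 2 otherwise.  That the differences form exactly G ∖ E then follows by counting: every
-- element outside E is a difference, and there are 6·#blocks = |G| - |E| differences.
module Submission where

open import Defs
open import Data.Nat using (ℕ; zero; suc; _+_; _*_; _∸_; _≤_; _<_; _^_; _%_; _/_; _≤?_; NonZero; z≤n; s≤s)
open import Data.Nat.Properties
  using ( *-suc; +-assoc; +-cancelʳ-≡; +-cancelʳ-≤; +-comm; +-identityʳ; +-mono-≤; +-monoʳ-≤; +-suc
        ; 0≢1+n; <-trans; <⇒≢; <⇒≤; m+1+n≰m; m+[n∸m]≡n; m+n∸n≡m; m<m+n; m∸n+n≡m; m≤m+n; m≤n+m
        ; n≢0⇒n>0; n≤0⇒n≡0; n≮n; suc-injective; ∸-monoʳ-<; ≤-antisym; ≤-reflexive; ≤-trans; ≰⇒>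
        ; module ≤-Reasoning )
open import Data.Nat.DivMod using (_mod_; m%n<n; m%n≤n; m<n⇒m%n≡m; m≡m%n+[m/n]*n; [m+kn]%n≡m%n)
open import Data.Nat.Divisibility using (_∣_; divides)
open import Data.Nat.ListAction using (sum)
open import Data.Nat.Tactic.RingSolver using (solve; solve-∀)
open import Data.Fin using (Fin; toℕ; zero; suc)
open import Data.Fin.Properties using (toℕ-fromℕ<; toℕ-injective; toℕ<n) renaming (_≟_ to _≟ᶠ_)
open import Data.Bool using (Bool; true; false; _xor_)
open import Data.Bool.Properties using (xor-identityˡ; xor-identityʳ; xor-comm; xor-same) renaming (_≟_ to _≟ᵇ_)
open import Data.Vec using (Vec; []; _∷_; replicate; zipWith)
open import Data.Vec.Properties
  using (≡-dec; ∷-injective; zipWith-identityˡ; zipWith-identityʳ; zipWith-inverseʳ; zipWith-comm; map-id)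
open import Data.List
  using (List; []; _∷_; _++_; map; length; concatMap; lookup; applyUpTo; upTo; allFin; cartesianProductWith; cartesianProduct)
open import Data.List.Properties using (length-++; length-map; length-tabulate; length-applyUpTo; length-upTo; map-cong)
open import Data.List.Membership.Propositional using (_∈_; _∉_; lose)
open import Data.List.Membership.Propositional.Properties
  using ( ∈-map⁺; ∈-map⁻; ∈-++⁺ˡ; ∈-++⁺ʳ; ∈-++⁻; ∈-concat⁺′; ∈-lookup; ∈-allFin; ∈-upTo⁺; ∈-applyUpTo⁺
        ; ∈-cartesianProductWith⁺; ∈-cartesianProduct⁺ )
open import Data.List.Relation.Unary.All using ([]; _∷_)
import Data.List.Relation.Unary.All as All
import Data.List.Relation.Unary.All.Properties as All
open import Data.List.Relation.Unary.AllPairs using ([]; _∷_)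
open import Data.List.Relation.Unary.Any using (Any; here; there)
import Data.List.Relation.Unary.Any as Any
import Data.List.Relation.Unary.Any.Properties as Any
open import Data.List.Relation.Unary.Unique.Propositional using (Unique)
import Data.List.Relation.Unary.Unique.Propositional.Properties as Unique
open import Data.Product using (Σ; _×_; _,_; proj₁; proj₂)
open import Data.Sum using (_⊎_; inj₁; inj₂)
open import Data.Empty using (⊥; ⊥-elim)
open import Function using (_∘_; _∋_)
open import Relation.Nullary using (¬_; Dec; yes; no)
open import Relation.Nullary.Decidable using (_⊎-dec_; _×-dec_)
open import Relation.Binary.PropositionalEquality hiding ([_])

-- Arithmetic modulo d

module Residues (d : ℕ) .{{_ : NonZero d}} where

  0ᵈ : Fin d
  0ᵈ = 0 mod d

  infixl 6 _+ᵈ_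
  infix  8 -ᵈ_

  _+ᵈ_ : Fin d → Fin d → Fin d
  a +ᵈ b = (toℕ a + toℕ b) mod d

  -ᵈ_ : Fin d → Fin d
  -ᵈ a = (d ∸ toℕ a) mod d

  -- Opaque, so that the unifier can read off n from [ n ].
  opaque
    [_] : ℕ → Fin d
    [ n ] = n mod d

  opaque
    unfolding [_]

    toℕ-[] : ∀ n → toℕ [ n ] ≡ n % d
    toℕ-[] n = toℕ-fromℕ< (m%n<n n d)

    [0]≡0ᵈ : [ 0 ] ≡ 0ᵈ
    [0]≡0ᵈ = refl

    -ᵈ≡[d∸toℕ] : ∀ y → -ᵈ y ≡ [ d ∸ toℕ y ]
    -ᵈ≡[d∸toℕ] y = refl

    +ᵈ≡[toℕ+toℕ] : ∀ y z → y +ᵈ z ≡ [ toℕ y + toℕ z ]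
    +ᵈ≡[toℕ+toℕ] y z = refl

  open ≡-Reasoning

  [toℕ] : ∀ y → [ toℕ y ] ≡ y
  [toℕ] y = toℕ-injective (trans (toℕ-[] (toℕ y)) (m<n⇒m%n≡m (toℕ<n y)))

  toℕ-[]< : ∀ {a} → a < d → toℕ [ a ] ≡ a
  toℕ-[]< {a} a<d = trans (toℕ-[] a) (m<n⇒m%n≡m a<d)

  []-cong : ∀ {a b} i j → a + i * d ≡ b + j * d → [ a ] ≡ [ b ]
  []-cong {a} {b} i j eq = toℕ-injective (begin
    toℕ [ a ]        ≡⟨ toℕ-[] a ⟩
    a % d            ≡⟨ [m+kn]%n≡m%n a i d ⟨
    (a + i * d) % d  ≡⟨ cong (_% d) eq ⟩
    (b + j * d) % d  ≡⟨ [m+kn]%n≡m%n b j d ⟩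
    b % d            ≡⟨ toℕ-[] b ⟨
    toℕ [ b ]        ∎)

  +ᵈ-[] : ∀ a b → [ a ] +ᵈ [ b ] ≡ [ a + b ]
  +ᵈ-[] a b = begin
    [ a ] +ᵈ [ b ]               ≡⟨ +ᵈ≡[toℕ+toℕ] [ a ] [ b ] ⟩
    [ toℕ [ a ] + toℕ [ b ] ]    ≡⟨ cong₂ (λ x y → [ x + y ]) (toℕ-[] a) (toℕ-[] b) ⟩
    [ a % d + b % d ]            ≡⟨ []-cong (a / d + b / d) 0 (begin
      a % d + b % d + (a / d + b / d) * d          ≡⟨ regroup (a % d) (b % d) (a / d) (b / d) d ⟩
      a % d + a / d * d + (b % d + b / d * d) + 0  ≡⟨ cong₂ (λ x y → x + y + 0) (m≡m%n+[m/n]*n a d) (m≡m%n+[m/n]*n b d) ⟨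
      a + b + 0 * d                                ∎) ⟩
    [ a + b ]                    ∎
    where
    regroup : ∀ r s p q n → r + s + (p + q) * n ≡ r + p * n + (s + q * n) + 0
    regroup = solve-∀

  d∸a%d+a : ∀ a → d ∸ a % d + a ≡ suc (a / d) * d
  d∸a%d+a a = begin
    d ∸ a % d + a                     ≡⟨ cong (d ∸ a % d +_) (m≡m%n+[m/n]*n a d) ⟩
    d ∸ a % d + (a % d + a / d * d)   ≡⟨ +-assoc (d ∸ a % d) (a % d) (a / d * d) ⟨
    d ∸ a % d + a % d + a / d * d     ≡⟨ cong (_+ a / d * d) (m∸n+n≡m (m%n≤n a d)) ⟩
    d + a / d * d                     ∎

  -ᵈ[] : ∀ a → -ᵈ [ a ] ≡ [ d ∸ a % d ]
  -ᵈ[] a = trans (-ᵈ≡[d∸toℕ] [ a ]) (cong (λ r → [ d ∸ r ]) (toℕ-[] a))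

  -ᵈ-[] : ∀ {a b} i → a + b ≡ i * d → -ᵈ [ a ] ≡ [ b ]
  -ᵈ-[] {a} {b} i eq = trans (-ᵈ[] a) ([]-cong i (suc (a / d)) (begin
    d ∸ a % d + i * d        ≡⟨ cong (d ∸ a % d +_) eq ⟨
    d ∸ a % d + (a + b)      ≡⟨ +-assoc (d ∸ a % d) a b ⟨
    d ∸ a % d + a + b        ≡⟨ cong (_+ b) (d∸a%d+a a) ⟩
    suc (a / d) * d + b      ≡⟨ +-comm (suc (a / d) * d) b ⟩
    b + suc (a / d) * d      ∎))

  +ᵈ-ᵈ-[] : ∀ {a b c} i j → a + i * d ≡ b + c + j * d → [ a ] +ᵈ -ᵈ [ b ] ≡ [ c ]
  +ᵈ-ᵈ-[] {a} {b} {c} i j eq = begin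
    [ a ] +ᵈ -ᵈ [ b ]          ≡⟨ cong ([ a ] +ᵈ_) (-ᵈ[] b) ⟩
    [ a ] +ᵈ [ d ∸ b % d ]     ≡⟨ +ᵈ-[] a (d ∸ b % d) ⟩
    [ a + (d ∸ b % d) ]        ≡⟨ []-cong i (j + suc (b / d)) (+-cancelʳ-≡ b _ _ (begin
      a + (d ∸ b % d) + i * d + b        ≡⟨ regroupˡ a (d ∸ b % d) (i * d) b ⟩
      a + i * d + (d ∸ b % d + b)        ≡⟨ cong₂ _+_ eq (d∸a%d+a b) ⟩
      b + c + j * d + suc (b / d) * d    ≡⟨ regroupʳ b c j (b / d) d ⟩
      c + (j + suc (b / d)) * d + b      ∎)) ⟩
    [ c ]                      ∎
    where
    regroupˡ : ∀ a r s b → a + r + s + b ≡ a + s + (r + b)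
    regroupˡ = solve-∀
    regroupʳ : ∀ b c j q n → b + c + j * n + suc q * n ≡ c + (j + suc q) * n + b
    regroupʳ = solve-∀

  -ᵈ-involutive : ∀ y → -ᵈ (-ᵈ y) ≡ y
  -ᵈ-involutive y = begin
    -ᵈ (-ᵈ y)              ≡⟨ cong -ᵈ_ (-ᵈ≡[d∸toℕ] y) ⟩
    -ᵈ [ d ∸ toℕ y ]       ≡⟨ -ᵈ-[] 1 (trans (m∸n+n≡m (<⇒≤ (toℕ<n y))) (sym (+-identityʳ d))) ⟩
    [ toℕ y ]              ≡⟨ [toℕ] y ⟩
    y                      ∎

  -ᵈ-swap : ∀ {y z} → -ᵈ y ≡ z → y ≡ -ᵈ z
  -ᵈ-swap {y} eq = trans (sym (-ᵈ-involutive y)) (cong -ᵈ_ eq)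

  -ᵈ-0ᵈ : -ᵈ 0ᵈ ≡ 0ᵈ
  -ᵈ-0ᵈ = begin
    -ᵈ 0ᵈ     ≡⟨ cong -ᵈ_ [0]≡0ᵈ ⟨
    -ᵈ [ 0 ]  ≡⟨ -ᵈ-[] 0 refl ⟩
    [ 0 ]     ≡⟨ [0]≡0ᵈ ⟩
    0ᵈ        ∎

  toℕ≢0 : ∀ {y} → y ≢ 0ᵈ → toℕ y ≢ 0
  toℕ≢0 {y} y≢0 toℕy≡0 = y≢0 (trans (sym ([toℕ] y)) (trans (cong [_] toℕy≡0) [0]≡0ᵈ))

  toℕ-ᵈ : ∀ {y} → y ≢ 0ᵈ → toℕ (-ᵈ y) + toℕ y ≡ d
  toℕ-ᵈ {y} y≢0 = begin
    toℕ (-ᵈ y) + toℕ y          ≡⟨ cong (λ z → toℕ z + toℕ y) (-ᵈ≡[d∸toℕ] y) ⟩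
    toℕ [ d ∸ toℕ y ] + toℕ y   ≡⟨ cong (_+ toℕ y) (trans (toℕ-[] (d ∸ toℕ y)) (m<n⇒m%n≡m d∸y<d)) ⟩
    d ∸ toℕ y + toℕ y           ≡⟨ m∸n+n≡m (<⇒≤ (toℕ<n y)) ⟩
    d                           ∎
    where
    d∸y<d : d ∸ toℕ y < d
    d∸y<d = ∸-monoʳ-< (n≢0⇒n>0 (toℕ≢0 y≢0)) (<⇒≤ (toℕ<n y))

  +ᵈ-identityˡ : ∀ y → 0ᵈ +ᵈ y ≡ y
  +ᵈ-identityˡ y = begin
    0ᵈ +ᵈ y              ≡⟨ cong₂ _+ᵈ_ [0]≡0ᵈ ([toℕ] y) ⟨
    [ 0 ] +ᵈ [ toℕ y ]   ≡⟨ +ᵈ-[] 0 (toℕ y) ⟩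
    [ toℕ y ]            ≡⟨ [toℕ] y ⟩
    y                    ∎

  +ᵈ-identityʳ : ∀ y → y +ᵈ 0ᵈ ≡ y
  +ᵈ-identityʳ y = begin
    y +ᵈ 0ᵈ              ≡⟨ cong₂ _+ᵈ_ ([toℕ] y) [0]≡0ᵈ ⟨
    [ toℕ y ] +ᵈ [ 0 ]   ≡⟨ +ᵈ-[] (toℕ y) 0 ⟩
    [ toℕ y + 0 ]        ≡⟨ cong [_] (+-identityʳ (toℕ y)) ⟩
    [ toℕ y ]            ≡⟨ [toℕ] y ⟩
    y                    ∎

  +ᵈ-inverseʳ : ∀ y → y +ᵈ -ᵈ y ≡ 0ᵈ
  +ᵈ-inverseʳ y = begin
    y +ᵈ -ᵈ y                  ≡⟨ cong (λ z → z +ᵈ -ᵈ z) ([toℕ] y) ⟨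
    [ toℕ y ] +ᵈ -ᵈ [ toℕ y ]  ≡⟨ +ᵈ-ᵈ-[] 0 0 (sym (+-identityʳ (toℕ y + 0))) ⟩
    [ 0 ]                      ≡⟨ [0]≡0ᵈ ⟩
    0ᵈ                         ∎

  -ᵈ-anticomm : ∀ y z → -ᵈ (y +ᵈ -ᵈ z) ≡ z +ᵈ -ᵈ y
  -ᵈ-anticomm y z = begin
    -ᵈ (y +ᵈ -ᵈ z)                   ≡⟨ cong (λ w → -ᵈ (y +ᵈ w)) (-ᵈ≡[d∸toℕ] z) ⟩
    -ᵈ (y +ᵈ [ d ∸ toℕ z ])          ≡⟨ cong (λ w → -ᵈ (w +ᵈ [ d ∸ toℕ z ])) ([toℕ] y) ⟨
    -ᵈ ([ toℕ y ] +ᵈ [ d ∸ toℕ z ])  ≡⟨ cong -ᵈ_ (+ᵈ-[] (toℕ y) (d ∸ toℕ z)) ⟩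
    -ᵈ [ toℕ y + (d ∸ toℕ z) ]       ≡⟨ -ᵈ-[] 2 (begin
      toℕ y + (d ∸ toℕ z) + (toℕ z + (d ∸ toℕ y))   ≡⟨ regroup (toℕ y) (d ∸ toℕ z) (toℕ z) (d ∸ toℕ y) ⟩
      toℕ y + (d ∸ toℕ y) + (toℕ z + (d ∸ toℕ z))
        ≡⟨ cong₂ _+_ (m+[n∸m]≡n (<⇒≤ (toℕ<n y))) (m+[n∸m]≡n (<⇒≤ (toℕ<n z))) ⟩
      d + d                                         ≡⟨ cong (d +_) (+-identityʳ d) ⟨
      2 * d                                         ∎) ⟩
    [ toℕ z + (d ∸ toℕ y) ]          ≡⟨ +ᵈ-[] (toℕ z) (d ∸ toℕ y) ⟨
    [ toℕ z ] +ᵈ [ d ∸ toℕ y ]       ≡⟨ cong₂ _+ᵈ_ ([toℕ] z) (sym (-ᵈ≡[d∸toℕ] y)) ⟩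
    z +ᵈ -ᵈ y                        ∎
    where
    regroup : ∀ a b c e → a + b + (c + e) ≡ a + e + (c + b)
    regroup = solve-∀

-- The group ℤ₂^m × ℤ_d

data PairRep (m : ℕ) : Set where
  rep : Vec Bool m → ℕ → Vec Bool m → ℕ → PairRep m

module Group (m d : ℕ) .{{_ : NonZero d}} where

  open Residues d public

  infixl 6 _+ᴳ_ _-ᴳ_
  infix  8 -ᴳ_

  0ᴳ : G m d
  0ᴳ = 0G m d

  _+ᴳ_ : G m d → G m d → G m d
  _+ᴳ_ = _⊕_ m d

  -ᴳ_ : G m d → G m d
  -ᴳ_ = ⊖_ m d

  _-ᴳ_ : G m d → G m d → G m d
  _-ᴳ_ = _⊝_ m d

  0ᵛ : Vec Bool m
  0ᵛ = replicate m false

  +ᴳ-identityˡ : ∀ x → 0ᴳ +ᴳ x ≡ x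
  +ᴳ-identityˡ (u , y) = cong₂ _,_ (zipWith-identityˡ xor-identityˡ u) (+ᵈ-identityˡ y)

  +ᴳ-identityʳ : ∀ x → x +ᴳ 0ᴳ ≡ x
  +ᴳ-identityʳ (u , y) = cong₂ _,_ (zipWith-identityʳ xor-identityʳ u) (+ᵈ-identityʳ y)

  -ᴳ-0ᴳ : -ᴳ 0ᴳ ≡ 0ᴳ
  -ᴳ-0ᴳ = cong (0ᵛ ,_) -ᵈ-0ᵈ

  -ᴳ-involutive : ∀ x → -ᴳ (-ᴳ x) ≡ x
  -ᴳ-involutive (u , y) = cong (u ,_) (-ᵈ-involutive y)

  -ᴳ-identityʳ : ∀ x → x -ᴳ 0ᴳ ≡ x
  -ᴳ-identityʳ x = trans (cong (x +ᴳ_) -ᴳ-0ᴳ) (+ᴳ-identityʳ x)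

  -ᴳ-self : ∀ x → x -ᴳ x ≡ 0ᴳ
  -ᴳ-self (u , y) = cong₂ _,_
    (trans (cong (zipWith _xor_ u) (sym (map-id u))) (zipWith-inverseʳ xor-same u))
    (+ᵈ-inverseʳ y)

  -ᴳ-anticomm : ∀ x z → z -ᴳ x ≡ -ᴳ (x -ᴳ z)
  -ᴳ-anticomm (u , y) (v , w) = cong₂ _,_ (zipWith-comm xor-comm v u) (sym (-ᵈ-anticomm y w))

  ΔT-closed-under-negation : ∀ T {g} → g ∈ ΔT m d T → -ᴳ g ∈ ΔT m d T
  ΔT-closed-under-negation (a , b , c) g∈ with g∈
  ... | here refl                                 = there (here (sym (-ᴳ-anticomm a b)))
  ... | there (here refl)                         = here (sym (-ᴳ-anticomm b a))
  ... | there (there (here refl))                 = there (there (there (here (sym (-ᴳ-anticomm a c)))))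
  ... | there (there (there (here refl)))         = there (there (here (sym (-ᴳ-anticomm c a))))
  ... | there (there (there (there (here refl)))) =
    there (there (there (there (there (here (sym (-ᴳ-anticomm b c)))))))
  ... | there (there (there (there (there (here refl))))) =
    there (there (there (there (here (sym (-ᴳ-anticomm c b))))))

  distinct-if-0∉ΔT : ∀ T → 0ᴳ ∉ ΔT m d T → Distinct3 m d T
  distinct-if-0∉ΔT (a , b , c) 0∉ΔT =
    (λ { refl → 0∉ΔT (here (sym (-ᴳ-self a))) }) ,
    (λ { refl → 0∉ΔT (there (there (here (sym (-ᴳ-self a))))) }) ,
    (λ { refl → 0∉ΔT (there (there (there (there (here (sym (-ᴳ-self b))))))) })

  map-isPartialSpread : ∀ {L : Set} (f : L → Subgroup m d) (label : G m d → L) →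
    (∀ l {x} → x ∈ elems (f l) → x ≢ 0ᴳ → label x ≡ l) →
    ∀ ls → Unique ls → IsPartialSpread m d (map f ls)
  map-isPartialSpread f label labelled (l ∷ ls) (l∉ls ∷ ls!) = spread
    where
    head-vs-tail : ∀ j {x} → x ∈ elems (f l) → x ∈ elems (lookup (map f ls) j) → x ≡ 0ᴳ
    head-vs-tail j {x} x∈l x∈j with _≟G_ m d x 0ᴳ | ∈-map⁻ f (∈-lookup j)
    ... | yes x≡0 | _                  = x≡0
    ... | no  x≢0 | l′ , l′∈ls , j≡l′ = ⊥-elim (All.lookup l∉ls l′∈ls
          (trans (sym (labelled l x∈l x≢0)) (labelled l′ (subst (λ S → x ∈ elems S) j≡l′ x∈j) x≢0)))
    spread : IsPartialSpread m d (map f (l ∷ ls))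
    spread zero    zero    i≢j = ⊥-elim (i≢j refl)
    spread zero    (suc j) _   x x∈i x∈j = head-vs-tail j x∈i x∈j
    spread (suc i) zero    _   x x∈i x∈j = head-vs-tail i x∈j x∈i
    spread (suc i) (suc j) i≢j = map-isPartialSpread f label labelled ls ls! i j (i≢j ∘ cong suc)

  triple : G m d × G m d → Triple m d
  triple (P , Q) = 0ᴳ , P , Q

  module _ (pq : G m d × G m d) where

    P∈ΔT : proj₁ pq ∈ ΔT m d (triple pq)
    P∈ΔT = there (here (sym (-ᴳ-identityʳ (proj₁ pq))))

    Q∈ΔT : proj₂ pq ∈ ΔT m d (triple pq)
    Q∈ΔT = there (there (there (here (sym (-ᴳ-identityʳ (proj₂ pq))))))

    P-Q∈ΔT : proj₁ pq -ᴳ proj₂ pq ∈ ΔT m d (triple pq)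
    P-Q∈ΔT = there (there (there (there (here refl))))

  pairOf : PairRep m → G m d × G m d
  pairOf (rep u a v b) = (u , [ a ]) , (v , [ b ])

  -- The ways (w , [ c ]) can be a difference of {0, (u , [ a ]), (v , [ b ])}.  A data type with
  -- these parameters, so that its equations are closed goals for the ring solver.
  data Difference (u : Vec Bool m) (a : ℕ) (v : Vec Bool m) (b : ℕ) (w : Vec Bool m) (c : ℕ) : Set where
    ≡P   : u ≡ w → c ≡ a → Difference u a v b w c
    ≡-P  : u ≡ w → a + c ≡ 1 * d → Difference u a v b w c
    ≡-Q  : v ≡ w → b + c ≡ 1 * d → Difference u a v b w c
    ≡P-Q : zipWith _xor_ u v ≡ w → ∀ i j → a + i * d ≡ b + c + j * d → Difference u a v b w c
    ≡Q-P : zipWith _xor_ v u ≡ w → ∀ i j → b + i * d ≡ a + c + j * d → Difference u a v b w c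

  IsDifference : PairRep m → Vec Bool m → ℕ → Set
  IsDifference (rep u a v b) = Difference u a v b

  isDifference⇒∈ΔT : ∀ p {w c} → IsDifference p w c → (w , [ c ]) ∈ ΔT m d (triple (pairOf p))
  isDifference⇒∈ΔT p@(rep u a v b) = differences
    where
    Δp : List (G m d)
    Δp = ΔT m d (triple (pairOf p))
    differences : ∀ {w c} → Difference u a v b w c → (w , [ c ]) ∈ Δp
    differences (≡P refl refl)      = P∈ΔT (pairOf p)
    differences (≡-P refl eq)       = subst (_∈ Δp) (cong (u ,_) (-ᵈ-[] 1 eq))
      (ΔT-closed-under-negation (triple (pairOf p)) (P∈ΔT (pairOf p)))
    differences (≡-Q refl eq)       = subst (_∈ Δp) (cong (v ,_) (-ᵈ-[] 1 eq))
      (ΔT-closed-under-negation (triple (pairOf p)) (Q∈ΔT (pairOf p)))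
    differences (≡P-Q refl i j eq)  = subst (_∈ Δp) (cong (zipWith _xor_ u v ,_) (+ᵈ-ᵈ-[] i j eq))
      (P-Q∈ΔT (pairOf p))
    differences (≡Q-P refl i j eq)  = subst (_∈ Δp)
      (trans (sym (-ᴳ-anticomm (u , [ a ]) (v , [ b ]))) (cong (zipWith _xor_ v u ,_) (+ᵈ-ᵈ-[] i j eq)))
      (ΔT-closed-under-negation (triple (pairOf p)) (P-Q∈ΔT (pairOf p)))

  infix 4 _∈Δ_

  _∈Δ_ : G m d → List (G m d × G m d) → Set
  g ∈Δ ps = Any (λ pq → g ∈ ΔT m d (triple pq)) ps

  ∈Δ-negation : ∀ {g ps} → g ∈Δ ps → -ᴳ g ∈Δ ps
  ∈Δ-negation = Any.map (λ {pq} → ΔT-closed-under-negation (triple pq))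

  ∈Δ⇒∈Δ𝒯 : ∀ {g ps} → g ∈Δ ps → g ∈ Δ𝒯 m d (map triple ps)
  ∈Δ⇒∈Δ𝒯 = Any.concat⁺ ∘ Any.map⁺ ∘ Any.map⁺

  length-Δ𝒯 : ∀ 𝒯 → length (Δ𝒯 m d 𝒯) ≡ 6 * length 𝒯
  length-Δ𝒯 []       = refl
  length-Δ𝒯 (T ∷ 𝒯) =
    trans (length-++ (ΔT m d T) {Δ𝒯 m d 𝒯}) (trans (cong (6 +_) (length-Δ𝒯 𝒯)) (sym (*-suc 6 (length 𝒯))))

-- Counting

length-cartesianProductWith : ∀ {A B C : Set} (f : A → B → C) xs ys →
  length (cartesianProductWith f xs ys) ≡ length xs * length ys
length-cartesianProductWith f []       ys = refl
length-cartesianProductWith f (x ∷ xs) ys = begin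
  length (map (f x) ys ++ cartesianProductWith f xs ys)  ≡⟨ length-++ (map (f x) ys) ⟩
  length (map (f x) ys) + length (cartesianProductWith f xs ys)
    ≡⟨ cong₂ _+_ (length-map (f x) ys) (length-cartesianProductWith f xs ys) ⟩
  length ys + length xs * length ys                      ∎
  where open ≡-Reasoning

allVecs : ∀ n → List (Vec Bool n)
allVecs zero    = [] ∷ []
allVecs (suc n) = cartesianProductWith _∷_ (false ∷ true ∷ []) (allVecs n)

∈-allVecs : ∀ {n} (v : Vec Bool n) → v ∈ allVecs n
∈-allVecs []          = here refl
∈-allVecs (false ∷ v) = ∈-cartesianProductWith⁺ _∷_ {xs = false ∷ true ∷ []} (here refl) (∈-allVecs v)
∈-allVecs (true ∷ v)  = ∈-cartesianProductWith⁺ _∷_ {xs = false ∷ true ∷ []} (there (here refl)) (∈-allVecs v)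

allVecs-unique : ∀ n → Unique (allVecs n)
allVecs-unique zero    = [] ∷ []
allVecs-unique (suc n) =
  Unique.cartesianProductWith⁺ {xs = false ∷ true ∷ []} _∷_ ∷-injective (((λ ()) ∷ []) ∷ [] ∷ []) (allVecs-unique n)

length-allVecs : ∀ n → length (allVecs n) ≡ 2 ^ n
length-allVecs zero    = refl
length-allVecs (suc n) =
  trans (length-cartesianProductWith _∷_ (false ∷ true ∷ []) (allVecs n)) (cong (2 *_) (length-allVecs n))

module _ {A : Set} (f : A → ℕ) where

  sum-map-+ : ∀ (g : A → ℕ) xs → sum (map (λ x → f x + g x) xs) ≡ sum (map f xs) + sum (map g xs)
  sum-map-+ g []       = refl
  sum-map-+ g (x ∷ xs) = trans (cong (f x + g x +_) (sum-map-+ g xs)) (regroup (f x) (g x) _ _)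
    where
    regroup : ∀ a b c e → a + b + (c + e) ≡ a + c + (b + e)
    regroup = solve-∀

  length≤sum : (∀ x → 1 ≤ f x) → ∀ xs → length xs ≤ sum (map f xs)
  length≤sum 1≤f []       = z≤n
  length≤sum 1≤f (x ∷ xs) = +-mono-≤ (1≤f x) (length≤sum 1≤f xs)

  module _ (1≤f : ∀ x → 1 ≤ f x) where

    private
      head-and-tail : ∀ y ys → sum (map f (y ∷ ys)) ≡ length (y ∷ ys) →
                      f y ≡ 1 × sum (map f ys) ≡ length ys
      head-and-tail y ys eq = fy≡1 , suc-injective (trans (cong (_+ sum (map f ys)) (sym fy≡1)) eq)
        where
        fy≤1 : f y ≤ 1
        fy≤1 = +-cancelʳ-≤ (length ys) (f y) 1
          (≤-trans (+-monoʳ-≤ (f y) (length≤sum 1≤f ys)) (≤-reflexive eq))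
        fy≡1 : f y ≡ 1
        fy≡1 = ≤-antisym fy≤1 (1≤f y)

    sum≡length⇒≡1 : ∀ xs → sum (map f xs) ≡ length xs → ∀ {x} → x ∈ xs → f x ≡ 1
    sum≡length⇒≡1 (y ∷ ys) eq (here refl) = proj₁ (head-and-tail y ys eq)
    sum≡length⇒≡1 (y ∷ ys) eq (there x∈)  = sum≡length⇒≡1 ys (proj₂ (head-and-tail y ys eq)) x∈

module Counting (m d : ℕ) .{{_ : NonZero d}} where

  count-++ : ∀ g xs ys → count m d g (xs ++ ys) ≡ count m d g xs + count m d g ys
  count-++ g []       ys = refl
  count-++ g (x ∷ xs) ys with _≟G_ m d g x
  ... | yes _ = cong suc (count-++ g xs ys)
  ... | no  _ = count-++ g xs ys

  count-∈ : ∀ {g xs} → g ∈ xs → 1 ≤ count m d g xs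
  count-∈ {g} {x ∷ xs} g∈ with _≟G_ m d g x | g∈
  ... | yes _   | _          = s≤s z≤n
  ... | no  g≢x | here g≡x   = ⊥-elim (g≢x g≡x)
  ... | no  _   | there g∈xs = count-∈ g∈xs

  count-∉ : ∀ {g} xs → g ∉ xs → count m d g xs ≡ 0
  count-∉ []       g∉ = refl
  count-∉ {g} (x ∷ xs) g∉ with _≟G_ m d g x
  ... | yes g≡x = ⊥-elim (g∉ (here g≡x))
  ... | no  _   = count-∉ xs (g∉ ∘ there)

  count-unique : ∀ {g xs} → Unique xs → g ∈ xs → count m d g xs ≡ 1
  count-unique {g} {x ∷ xs} (x∉xs ∷ xs!) g∈ with _≟G_ m d g x | g∈
  ... | yes refl | _          = cong suc (count-∉ xs (λ g∈xs → All.lookup x∉xs g∈xs refl))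
  ... | no  g≢x  | here g≡x   = ⊥-elim (g≢x g≡x)
  ... | no  _    | there g∈xs = count-unique xs! g∈xs

  count-singleton-sym : ∀ g x → count m d g (x ∷ []) ≡ count m d x (g ∷ [])
  count-singleton-sym g x with _≟G_ m d g x | _≟G_ m d x g
  ... | yes _   | yes _   = refl
  ... | yes g≡x | no  x≢g = ⊥-elim (x≢g (sym g≡x))
  ... | no  g≢x | yes x≡g = ⊥-elim (g≢x (sym x≡g))
  ... | no  _   | no  _   = refl

  sum-count-singleton : ∀ x es → sum (map (λ g → count m d g (x ∷ [])) es) ≡ count m d x es
  sum-count-singleton x []       = refl
  sum-count-singleton x (e ∷ es) = begin
    count m d e (x ∷ []) + sum (map (λ g → count m d g (x ∷ [])) es)
      ≡⟨ cong₂ _+_ (count-singleton-sym e x) (sum-count-singleton x es) ⟩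
    count m d x (e ∷ []) + count m d x es
      ≡⟨ count-++ x (e ∷ []) es ⟨
    count m d x (e ∷ es) ∎
    where open ≡-Reasoning

  module _ {es : List (G m d)} (es! : Unique es) (∈es : ∀ g → g ∈ es) where

    sum-count : ∀ ys → sum (map (λ g → count m d g ys) es) ≡ length ys
    sum-count []       = sum-zeros es
      where
      sum-zeros : ∀ xs → sum (map (λ g → count m d g []) xs) ≡ 0
      sum-zeros []       = refl
      sum-zeros (_ ∷ xs) = sum-zeros xs
    sum-count (y ∷ ys) = begin
      sum (map (λ g → count m d g (y ∷ ys)) es)
        ≡⟨ cong sum (map-cong (λ g → count-++ g (y ∷ []) ys) es) ⟩
      sum (map (λ g → count m d g (y ∷ []) + count m d g ys) es)
        ≡⟨ sum-map-+ (λ g → count m d g (y ∷ [])) (λ g → count m d g ys) es ⟩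
      sum (map (λ g → count m d g (y ∷ [])) es) + sum (map (λ g → count m d g ys) es)
        ≡⟨ cong₂ _+_ (sum-count-singleton y es) (sum-count ys) ⟩
      count m d y es + length ys
        ≡⟨ cong (_+ length ys) (count-unique es! (∈es y)) ⟩
      suc (length ys) ∎
      where open ≡-Reasoning

    count≡1 : ∀ ys → (∀ g → g ∈ ys) → length ys ≡ length es → ∀ g → count m d g ys ≡ 1
    count≡1 ys ∈ys len g =
      sum≡length⇒≡1 (λ g → count m d g ys) (λ g → count-∈ (∈ys g)) es (trans (sum-count ys) len) (∈es g)

  allG : List (G m d)
  allG = cartesianProduct (allVecs m) (allFin d)

  allG-unique : Unique allG
  allG-unique = Unique.cartesianProduct⁺ (allVecs-unique m) (Unique.allFin⁺ d)

  ∈-allG : ∀ g → g ∈ allG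
  ∈-allG (u , y) = ∈-cartesianProduct⁺ (∈-allVecs u) (∈-allFin y)

  length-allG : length allG ≡ 2 ^ m * d
  length-allG = trans (length-cartesianProductWith _,_ (allVecs m) (allFin d))
                      (cong₂ _*_ (length-allVecs m) (length-tabulate (λ i → i)))

-- The construction

data Cut (a b : ℕ) : Set where
  below : ∀ x → b ≡ suc (a + x) → Cut a b
  above : ∀ e → a ≡ b + e → Cut a b

cut : ∀ a b → Cut a b
cut zero    zero    = above 0 refl
cut zero    (suc b) = below b refl
cut (suc a) zero    = above (suc a) refl
cut (suc a) (suc b) with cut a b
... | below x eq = below x (cong suc eq)
... | above e eq = above e (cong suc eq)

data Parity : ℕ → Set where
  even : ∀ h → Parity (h + h)
  odd  : ∀ h → Parity (suc (h + h))

parity : ∀ c → Parity c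
parity zero = even 0
parity (suc c) with parity c
... | even h = odd h
... | odd  h = subst Parity (cong suc (+-suc h h)) (even (suc h))

-- Blockwise multiplication by a root of x² + x + 1 in GF(4) ≅ ℤ₂², so that 1 + ω = ω².
ω : ∀ q → Vec Bool (q * 2) → Vec Bool (q * 2)
ω zero    []          = []
ω (suc q) (a ∷ b ∷ u) = b ∷ (a xor b) ∷ ω q u

ω³≡id : ∀ q (u : Vec Bool (q * 2)) → ω q (ω q (ω q u)) ≡ u
ω³≡id zero    []                  = refl
ω³≡id (suc q) (false ∷ false ∷ u) = cong (λ v → false ∷ false ∷ v) (ω³≡id q u)
ω³≡id (suc q) (false ∷ true  ∷ u) = cong (λ v → false ∷ true ∷ v) (ω³≡id q u)
ω³≡id (suc q) (true  ∷ false ∷ u) = cong (λ v → true ∷ false ∷ v) (ω³≡id q u)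
ω³≡id (suc q) (true  ∷ true  ∷ u) = cong (λ v → true ∷ true ∷ v) (ω³≡id q u)

1+ω≡ω² : ∀ q (u : Vec Bool (q * 2)) → zipWith _xor_ u (ω q u) ≡ ω q (ω q u)
1+ω≡ω² zero    []                  = refl
1+ω≡ω² (suc q) (false ∷ false ∷ u) = cong (λ v → false ∷ false ∷ v) (1+ω≡ω² q u)
1+ω≡ω² (suc q) (false ∷ true  ∷ u) = cong (λ v → true ∷ false ∷ v) (1+ω≡ω² q u)
1+ω≡ω² (suc q) (true  ∷ false ∷ u) = cong (λ v → true ∷ true ∷ v) (1+ω≡ω² q u)
1+ω≡ω² (suc q) (true  ∷ true  ∷ u) = cong (λ v → false ∷ true ∷ v) (1+ω≡ω² q u)

module Construction (k : ℕ) where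

  d t n : ℕ
  d = 3 + k * 6
  t = 1 + k * 2
  n = 1 + k * 3

  -- The ring solver needs its variable list at a known type, as [] and _∷_ are overloaded here.
  d≡t+t+t : 3 + k * 6 ≡ (1 + k * 2) + ((1 + k * 2) + (1 + k * 2))
  d≡t+t+t = solve (List ℕ ∋ k ∷ [])

  d≡n+1+n : 3 + k * 6 ≡ (1 + k * 3) + suc (1 + k * 3)
  d≡n+1+n = solve (List ℕ ∋ k ∷ [])

  module Level (m : ℕ) where

    open Group m d public
    open Counting m d

    -- Membership in the union of the spread below.
    Exceptional : G m d → Set
    Exceptional (u , y) = y ≡ 0ᵈ ⊎ (u ≡ 0ᵛ × (y ≡ [ t ] ⊎ y ≡ [ t + t ]))

    exceptional? : ∀ g → Dec (Exceptional g)
    exceptional? (u , y) = y ≟ᶠ 0ᵈ ⊎-dec (≡-dec _≟ᵇ_ u 0ᵛ ×-dec (y ≟ᶠ [ t ] ⊎-dec y ≟ᶠ [ t + t ]))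

    -ᵈ[t] : -ᵈ [ t ] ≡ [ t + t ]
    -ᵈ[t] = -ᵈ-[] 1 (trans (sym d≡t+t+t) (sym (+-identityʳ d)))

    -ᵈ[t+t] : -ᵈ [ t + t ] ≡ [ t ]
    -ᵈ[t+t] = -ᵈ-[] 1 (trans (+-comm (t + t) t) (trans (sym d≡t+t+t) (sym (+-identityʳ d))))

    exceptional-negation : ∀ g → Exceptional (-ᴳ g) → Exceptional g
    exceptional-negation (u , y) (inj₁ -y≡0)               = inj₁ (trans (-ᵈ-swap -y≡0) -ᵈ-0ᵈ)
    exceptional-negation (u , y) (inj₂ (u≡0 , inj₁ -y≡t))  = inj₂ (u≡0 , inj₂ (trans (-ᵈ-swap -y≡t) -ᵈ[t]))
    exceptional-negation (u , y) (inj₂ (u≡0 , inj₂ -y≡2t)) = inj₂ (u≡0 , inj₁ (trans (-ᵈ-swap -y≡2t) -ᵈ[t+t]))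

    exceptionals : List (G m d)
    exceptionals = map (_, 0ᵈ) (allVecs m) ++ (0ᵛ , [ t ]) ∷ (0ᵛ , [ t + t ]) ∷ []

    length-exceptionals : length exceptionals ≡ 2 ^ m + 2
    length-exceptionals = trans (length-++ (map (_, 0ᵈ) (allVecs m)))
      (cong (_+ 2) (trans (length-map (_, 0ᵈ) (allVecs m)) (length-allVecs m)))

    exceptional⇒∈ : ∀ {g} → Exceptional g → g ∈ exceptionals
    exceptional⇒∈ {u , _} (inj₁ refl)     = ∈-++⁺ˡ (∈-map⁺ (_, 0ᵈ) (∈-allVecs u))
    exceptional⇒∈ (inj₂ (refl , inj₁ refl)) = ∈-++⁺ʳ (map (_, 0ᵈ) (allVecs m)) (here refl)
    exceptional⇒∈ (inj₂ (refl , inj₂ refl)) = ∈-++⁺ʳ (map (_, 0ᵈ) (allVecs m)) (there (here refl))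

    CoversHalf : List (G m d × G m d) → Set
    CoversHalf ps = ∀ u c → 1 ≤ c → c ≤ n → ¬ Exceptional (u , [ c ]) → (u , [ c ]) ∈Δ ps

    covered-via-toℕ : ∀ ps → CoversHalf ps → ∀ u y → toℕ y ≤ n → ¬ Exceptional (u , y) → (u , y) ∈Δ ps
    covered-via-toℕ ps half u y y≤n ¬exc = subst (λ z → (u , z) ∈Δ ps) ([toℕ] y)
      (half u (toℕ y) (n≢0⇒n>0 (toℕ≢0 (¬exc ∘ inj₁))) y≤n (¬exc ∘ subst (λ z → Exceptional (u , z)) ([toℕ] y)))

    -- Differences come in pairs ± g and d = 2n + 1, so it suffices to cover 1 ≤ c ≤ n in every row.
    covers-by-halves : ∀ ps → CoversHalf ps → ∀ g → ¬ Exceptional g → g ∈Δ ps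
    covers-by-halves ps half (u , y) ¬exc with toℕ y ≤? n
    ... | yes y≤n = covered-via-toℕ ps half u y y≤n ¬exc
    ... | no  y≰n = subst (_∈Δ ps) (-ᴳ-involutive (u , y))
                      (∈Δ-negation (covered-via-toℕ ps half u (-ᵈ y) -y≤n (¬exc ∘ exceptional-negation (u , y))))
      where
      open ≤-Reasoning
      -y≤n : toℕ (-ᵈ y) ≤ n
      -y≤n = +-cancelʳ-≤ (toℕ y) (toℕ (-ᵈ y)) n (begin
        toℕ (-ᵈ y) + toℕ y  ≡⟨ toℕ-ᵈ (¬exc ∘ inj₁) ⟩
        d                   ≡⟨ d≡n+1+n ⟩
        n + suc n           ≤⟨ +-monoʳ-≤ n (≰⇒> y≰n) ⟩
        n + toℕ y           ∎)

    record BaseBlocks : Set where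
      field
        pairs  : List (G m d × G m d)
        covers : ∀ g → ¬ Exceptional g → g ∈Δ pairs
        size   : 3 * length pairs + 1 ≡ 2 ^ m * n

    pairSubgroup : (v : Vec Bool m) → 0ᵛ ≢ v → Subgroup m d
    pairSubgroup v 0≢v = record
      { elems    = 0ᴳ ∷ p ∷ []
      ; distinct = ((λ 0≡p → 0≢v (cong proj₁ 0≡p)) ∷ []) ∷ [] ∷ []
      ; has-0    = here refl
      ; closed-+ = closed-under-+
      ; closed-⁻ = closed-under-⁻
      }
      where
      p : G m d
      p = v , 0ᵈ
      -p≡p : -ᴳ p ≡ p
      -p≡p = cong (v ,_) -ᵈ-0ᵈ
      closed-under-+ : ∀ {x y} → x ∈ 0ᴳ ∷ p ∷ [] → y ∈ 0ᴳ ∷ p ∷ [] → x +ᴳ y ∈ 0ᴳ ∷ p ∷ []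
      closed-under-+ (here refl)         y∈          = subst (_∈ 0ᴳ ∷ p ∷ []) (sym (+ᴳ-identityˡ _)) y∈
      closed-under-+ (there (here refl)) (here refl) = there (here (+ᴳ-identityʳ p))
      closed-under-+ (there (here refl)) (there (here refl)) =
        here (trans (cong (p +ᴳ_) (sym -p≡p)) (-ᴳ-self p))
      closed-under-⁻ : ∀ {x} → x ∈ 0ᴳ ∷ p ∷ [] → -ᴳ x ∈ 0ᴳ ∷ p ∷ []
      closed-under-⁻ (here refl)         = here -ᴳ-0ᴳ
      closed-under-⁻ (there (here refl)) = there (here -p≡p)

    t+t<d : t + t < d
    t+t<d = subst (t + t <_) (trans (+-comm (t + t) t) (sym d≡t+t+t)) (m<m+n (t + t) (s≤s z≤n))

    t<d : t < d
    t<d = <-trans (m<m+n t (s≤s z≤n)) t+t<d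

    tripleSubgroup : Subgroup m d
    tripleSubgroup = record
      { elems    = E
      ; distinct = (0≢a ∷ 0≢b ∷ []) ∷ (a≢b ∷ []) ∷ [] ∷ []
      ; has-0    = here refl
      ; closed-+ = closed-under-+
      ; closed-⁻ = closed-under-⁻
      }
      where
      a b : G m d
      a = 0ᵛ , [ t ]
      b = 0ᵛ , [ t + t ]
      E : List (G m d)
      E = 0ᴳ ∷ a ∷ b ∷ []

      value : G m d → ℕ
      value = toℕ ∘ proj₂
      0≢a : 0ᴳ ≢ a
      0≢a 0≡a = 0≢1+n (trans (cong value 0≡a) (toℕ-[]< t<d))
      0≢b : 0ᴳ ≢ b
      0≢b 0≡b = 0≢1+n (trans (cong value 0≡b) (toℕ-[]< t+t<d))
      a≢b : a ≢ b
      a≢b a≡b = <⇒≢ (m<m+n t (s≤s z≤n)) (trans (sym (toℕ-[]< t<d)) (trans (cong value a≡b) (toℕ-[]< t+t<d)))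

      3t≡d : (1 + k * 2) + ((1 + k * 2) + (1 + k * 2)) + 0 * (3 + k * 6) ≡ 0 + 1 * (3 + k * 6)
      3t≡d = solve (List ℕ ∋ k ∷ [])
      4t≡t+d : (1 + k * 2) + (1 + k * 2) + ((1 + k * 2) + (1 + k * 2)) + 0 * (3 + k * 6) ≡ (1 + k * 2) + 1 * (3 + k * 6)
      4t≡t+d = solve (List ℕ ∋ k ∷ [])

      in-row-0 : ∀ y z {w} → y +ᵈ z ≡ w → (0ᵛ , y) +ᴳ (0ᵛ , z) ≡ (0ᵛ , w)
      in-row-0 y z = cong₂ _,_ (zipWith-identityˡ xor-identityˡ 0ᵛ)
      a+a≡b : a +ᴳ a ≡ b
      a+a≡b = in-row-0 [ t ] [ t ] (+ᵈ-[] t t)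
      a+b≡0 : a +ᴳ b ≡ 0ᴳ
      a+b≡0 = in-row-0 [ t ] [ t + t ] (trans (+ᵈ-[] t (t + t)) (trans ([]-cong 0 1 3t≡d) [0]≡0ᵈ))
      b+a≡0 : b +ᴳ a ≡ 0ᴳ
      b+a≡0 = in-row-0 [ t + t ] [ t ]
        (trans (+ᵈ-[] (t + t) t) (trans (cong [_] (+-comm (t + t) t)) (trans ([]-cong 0 1 3t≡d) [0]≡0ᵈ)))
      b+b≡a : b +ᴳ b ≡ a
      b+b≡a = in-row-0 [ t + t ] [ t + t ] (trans (+ᵈ-[] (t + t) (t + t)) ([]-cong 0 1 4t≡t+d))

      closed-under-+ : ∀ {x y} → x ∈ E → y ∈ E → x +ᴳ y ∈ E
      closed-under-+ (here refl)                 y∈                          = subst (_∈ E) (sym (+ᴳ-identityˡ _)) y∈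
      closed-under-+ (there (here refl))         (here refl)                 = there (here (+ᴳ-identityʳ a))
      closed-under-+ (there (here refl))         (there (here refl))         = there (there (here a+a≡b))
      closed-under-+ (there (here refl))         (there (there (here refl))) = here a+b≡0
      closed-under-+ (there (there (here refl))) (here refl)                 = there (there (here (+ᴳ-identityʳ b)))
      closed-under-+ (there (there (here refl))) (there (here refl))         = here b+a≡0
      closed-under-+ (there (there (here refl))) (there (there (here refl))) = there (here b+b≡a)

      closed-under-⁻ : ∀ {x} → x ∈ E → -ᴳ x ∈ E
      closed-under-⁻ (here refl)                 = here -ᴳ-0ᴳ
      closed-under-⁻ (there (here refl))         = there (there (here (cong (0ᵛ ,_) -ᵈ[t])))
      closed-under-⁻ (there (there (here refl))) = there (here (cong (0ᵛ ,_) -ᵈ[t+t]))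

    subgroupOver : (v : Vec Bool m) → Dec (0ᵛ ≡ v) → Subgroup m d
    subgroupOver v (yes _)   = tripleSubgroup
    subgroupOver v (no 0≢v)  = pairSubgroup v 0≢v

    spreadMember : Vec Bool m → Subgroup m d
    spreadMember v = subgroupOver v (≡-dec _≟ᵇ_ 0ᵛ v)

    spread : List (Subgroup m d)
    spread = map spreadMember (allVecs m)

    nonzero-elements-lie-over : ∀ v (0≟v : Dec (0ᵛ ≡ v)) {x} →
      x ∈ elems (subgroupOver v 0≟v) → x ≢ 0ᴳ → proj₁ x ≡ v
    nonzero-elements-lie-over v (yes 0≡v) (here refl)                 x≢0 = ⊥-elim (x≢0 refl)
    nonzero-elements-lie-over v (yes 0≡v) (there (here refl))         _   = 0≡v
    nonzero-elements-lie-over v (yes 0≡v) (there (there (here refl))) _   = 0≡v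
    nonzero-elements-lie-over v (no _)    (here refl)                 x≢0 = ⊥-elim (x≢0 refl)
    nonzero-elements-lie-over v (no _)    (there (here refl))         _   = refl

    spread-isPartialSpread : IsPartialSpread m d spread
    spread-isPartialSpread = map-isPartialSpread spreadMember proj₁
      (λ v → nonzero-elements-lie-over v (≡-dec _≟ᵇ_ 0ᵛ v)) (allVecs m) (allVecs-unique m)

    numOfOrder-3-∉ : ∀ vs → 0ᵛ ∉ vs → numOfOrder m d 3 (map spreadMember vs) ≡ 0
    numOfOrder-3-∉ []       _   = refl
    numOfOrder-3-∉ (v ∷ vs) 0∉ with ≡-dec _≟ᵇ_ 0ᵛ v
    ... | yes 0≡v = ⊥-elim (0∉ (here 0≡v))
    ... | no  _   = numOfOrder-3-∉ vs (0∉ ∘ there)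

    numOfOrder-3 : ∀ vs → Unique vs → 0ᵛ ∈ vs → numOfOrder m d 3 (map spreadMember vs) ≡ 1
    numOfOrder-3 (v ∷ vs) (v∉vs ∷ vs!) 0∈ with ≡-dec _≟ᵇ_ 0ᵛ v | 0∈
    ... | yes refl | _          = cong suc (numOfOrder-3-∉ vs (λ 0∈vs → All.lookup v∉vs 0∈vs refl))
    ... | no  0≢v  | here 0≡v   = ⊥-elim (0≢v 0≡v)
    ... | no  _    | there 0∈vs = numOfOrder-3 vs vs! 0∈vs

    numOfOrder-2+3 : ∀ vs → numOfOrder m d 2 (map spreadMember vs) + numOfOrder m d 3 (map spreadMember vs) ≡ length vs
    numOfOrder-2+3 []       = refl
    numOfOrder-2+3 (v ∷ vs) with ≡-dec _≟ᵇ_ 0ᵛ v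
    ... | yes _ = trans (+-suc _ _) (cong suc (numOfOrder-2+3 vs))
    ... | no  _ = cong suc (numOfOrder-2+3 vs)

    spread-hasType : HasType-2-3 m d (2 ^ m ∸ 1) spread
    spread-hasType = All.map⁺ (All.universal (λ v → orders v (≡-dec _≟ᵇ_ 0ᵛ v)) (allVecs m)) , two , three
      where
      three : numOfOrder m d 3 spread ≡ 1
      three = numOfOrder-3 (allVecs m) (allVecs-unique m) (∈-allVecs 0ᵛ)
      two : numOfOrder m d 2 spread ≡ 2 ^ m ∸ 1
      two = begin
        numOfOrder m d 2 spread                                      ≡⟨ m+n∸n≡m _ 1 ⟨
        numOfOrder m d 2 spread + 1 ∸ 1                              ≡⟨ cong (λ z → numOfOrder m d 2 spread + z ∸ 1) three ⟨
        numOfOrder m d 2 spread + numOfOrder m d 3 spread ∸ 1        ≡⟨ cong (_∸ 1) (numOfOrder-2+3 (allVecs m)) ⟩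
        length (allVecs m) ∸ 1                                       ≡⟨ cong (_∸ 1) (length-allVecs m) ⟩
        2 ^ m ∸ 1                                                    ∎
        where open ≡-Reasoning
      orders : ∀ v 0≟v → order m d (subgroupOver v 0≟v) ≡ 2 ⊎ order m d (subgroupOver v 0≟v) ≡ 3
      orders v (yes _) = inj₂ refl
      orders v (no _)  = inj₁ refl

    subgroupOver-exceptional : ∀ v 0≟v {x} → x ∈ elems (subgroupOver v 0≟v) → Exceptional x
    subgroupOver-exceptional v (yes _) (here refl)                 = inj₁ refl
    subgroupOver-exceptional v (yes _) (there (here refl))         = inj₂ (refl , inj₁ refl)
    subgroupOver-exceptional v (yes _) (there (there (here refl))) = inj₂ (refl , inj₂ refl)
    subgroupOver-exceptional v (no _)  (here refl)                 = inj₁ refl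
    subgroupOver-exceptional v (no _)  (there (here refl))         = inj₁ refl

    union⇒exceptional : ∀ {g} → InUnion m d spread g → Exceptional g
    union⇒exceptional g∈ with Any.satisfied (Any.map⁻ g∈)
    ... | v , g∈over = subgroupOver-exceptional v (≡-dec _≟ᵇ_ 0ᵛ v) g∈over

    exceptionals⊆union : ∀ {g} → g ∈ exceptionals → InUnion m d spread g
    exceptionals⊆union g∈ with ∈-++⁻ (map (_, 0ᵈ) (allVecs m)) g∈
    ... | inj₁ g∈row-0 with ∈-map⁻ (_, 0ᵈ) g∈row-0
    ...   | u , u∈ , refl = Any.map⁺ (lose u∈ (zero-over u (≡-dec _≟ᵇ_ 0ᵛ u)))
      where
      zero-over : ∀ u 0≟u → (u , 0ᵈ) ∈ elems (subgroupOver u 0≟u)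
      zero-over u (yes 0≡u) = here (cong (_, 0ᵈ) (sym 0≡u))
      zero-over u (no _)    = there (here refl)
    exceptionals⊆union g∈ | inj₂ g∈ts =
      Any.map⁺ (lose (∈-allVecs 0ᵛ) (multiples-of-t (≡-dec _≟ᵇ_ 0ᵛ 0ᵛ) g∈ts))
      where
      multiples-of-t : ∀ 0≟0 {g} → g ∈ (0ᵛ , [ t ]) ∷ (0ᵛ , [ t + t ]) ∷ [] → g ∈ elems (subgroupOver 0ᵛ 0≟0)
      multiples-of-t (yes _)  (here refl)         = there (here refl)
      multiples-of-t (yes _)  (there (here refl)) = there (there (here refl))
      multiples-of-t (no 0≢0) _                   = ⊥-elim (0≢0 refl)

    module _ (B : BaseBlocks) where

      open BaseBlocks B

      private
        Δ : List (G m d)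
        Δ = Δ𝒯 m d (map triple pairs)

        length-Δ++exceptionals : length (Δ ++ exceptionals) ≡ length allG
        length-Δ++exceptionals = begin
          length (Δ ++ exceptionals)          ≡⟨ length-++ Δ ⟩
          length Δ + length exceptionals
            ≡⟨ cong₂ _+_ (trans (length-Δ𝒯 (map triple pairs)) (cong (6 *_) (length-map triple pairs))) length-exceptionals ⟩
          6 * length pairs + (2 ^ m + 2)      ≡⟨ regroup (length pairs) (2 ^ m) ⟩
          2 * (3 * length pairs + 1) + 2 ^ m  ≡⟨ cong (λ z → 2 * z + 2 ^ m) size ⟩
          2 * (2 ^ m * n) + 2 ^ m             ≡⟨ expand (2 ^ m) k ⟩
          2 ^ m * d                           ≡⟨ length-allG ⟨
          length allG                         ∎
          where
          open ≡-Reasoning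
          regroup : ∀ l p → 6 * l + (p + 2) ≡ 2 * (3 * l + 1) + p
          regroup = solve-∀
          expand : ∀ p k → 2 * (p * (1 + k * 3)) + p ≡ p * (3 + k * 6)
          expand = solve-∀

        ∈Δ++exceptionals : ∀ g → g ∈ Δ ++ exceptionals
        ∈Δ++exceptionals g with exceptional? g
        ... | yes exc  = ∈-++⁺ʳ Δ (exceptional⇒∈ exc)
        ... | no  ¬exc = ∈-++⁺ˡ (∈Δ⇒∈Δ𝒯 (covers g ¬exc))

        -- Δ ++ exceptionals contains every element of G and has |G| entries.
        count-split : ∀ g → count m d g Δ + count m d g exceptionals ≡ 1
        count-split g = trans (sym (count-++ g Δ exceptionals))
          (count≡1 allG-unique ∈-allG (Δ ++ exceptionals) ∈Δ++exceptionals length-Δ++exceptionals g)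

        count-exceptional : ∀ {g} → g ∈ exceptionals → count m d g Δ ≡ 0
        count-exceptional {g} g∈ = n≤0⇒n≡0 (+-cancelʳ-≤ 1 (count m d g Δ) 0
          (≤-trans (+-monoʳ-≤ (count m d g Δ) (count-∈ g∈)) (≤-reflexive (count-split g))))

        count-outside-union : ∀ g → ¬ InUnion m d spread g → count m d g Δ ≡ 1
        count-outside-union g g∉ = begin
          count m d g Δ                                ≡⟨ +-identityʳ _ ⟨
          count m d g Δ + 0                            ≡⟨ cong (count m d g Δ +_) (count-∉ exceptionals (g∉ ∘ exceptionals⊆union)) ⟨
          count m d g Δ + count m d g exceptionals     ≡⟨ count-split g ⟩
          1                                            ∎
          where open ≡-Reasoning

        triple-distinct : ∀ {T} → T ∈ map triple pairs → Distinct3 m d T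
        triple-distinct {T} T∈ = distinct-if-0∉ΔT T λ 0∈ΔT →
          1≰0 (subst (1 ≤_) (count-exceptional (exceptional⇒∈ (inj₁ refl)))
                            (count-∈ (Any.concat⁺ (Any.map⁺ (lose T∈ 0∈ΔT)))))
          where
          1≰0 : ¬ 1 ≤ 0
          1≰0 ()

      differenceFamily : IsDifferenceFamily m d spread (map triple pairs)
      differenceFamily = All.tabulate triple-distinct , λ g →
        count-exceptional ∘ exceptional⇒∈ ∘ union⇒exceptional , count-outside-union g

  module Step (q : ℕ) where

    private
      module Lo = Level (q * 2)
      module Hi = Level (suc q * 2)
    open Hi using ([_]; -ᵈ_; _+ᵈ_; +ᵈ-[]; -ᵈ-[]; -ᵈ-involutive; P∈ΔT; Q∈ΔT; P-Q∈ΔT; ΔT-closed-under-negation)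

    lift : G (q * 2) d → G (suc q * 2) d
    lift (u , y) = false ∷ false ∷ u , y

    liftPair : G (q * 2) d × G (q * 2) d → G (suc q * 2) d × G (suc q * 2) d
    liftPair (P , Q) = lift P , lift Q

    -- P - Q = (1 1 ω²u , 2x), so the three nonzero prefixes 10, 01, 11 are all reached.
    newPair : Vec Bool (q * 2) × ℕ → G (suc q * 2) d × G (suc q * 2) d
    newPair (u , x) = (true ∷ false ∷ u , [ x ]) , (false ∷ true ∷ ω q u , -ᵈ [ x ])

    newPairs : List (G (suc q * 2) d × G (suc q * 2) d)
    newPairs = map newPair (cartesianProduct (allVecs (q * 2)) (applyUpTo suc n))

    via-newPair : ∀ u x₀ → x₀ < n → ∀ {g} → g ∈ ΔT (suc q * 2) d (Hi.triple (newPair (u , suc x₀))) →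
      g Hi.∈Δ newPairs
    via-newPair u x₀ x₀<n = Any.map⁺ ∘ lose (∈-cartesianProduct⁺ (∈-allVecs u) (∈-applyUpTo⁺ suc x₀<n))

    newPair-difference : ∀ w x →
      (true ∷ false ∷ ω q w , [ x ]) Hi.-ᴳ (false ∷ true ∷ ω q (ω q w) , -ᵈ [ x ]) ≡ (true ∷ true ∷ w , [ x + x ])
    newPair-difference w x = cong₂ (λ v y → true ∷ true ∷ v , y)
      (trans (1+ω≡ω² q (ω q w)) (ω³≡id q w))
      (trans (cong ([ x ] +ᵈ_) (-ᵈ-involutive [ x ])) (+ᵈ-[] x x))

    lift-exceptional : ∀ {g} → Lo.Exceptional g → Hi.Exceptional (lift g)
    lift-exceptional (inj₁ y≡0)        = inj₁ y≡0
    lift-exceptional (inj₂ (refl , r)) = inj₂ (refl , r)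

    lift-∈Δ : ∀ {g ps} → g Lo.∈Δ ps → lift g Hi.∈Δ map liftPair ps
    lift-∈Δ = Any.map⁺ ∘ Any.map (∈-map⁺ lift)

    row-11 : ∀ w c → 1 ≤ c → c ≤ n → (true ∷ true ∷ w , [ c ]) Hi.∈Δ newPairs
    row-11 w c 1≤c c≤n with parity c
    row-11 w _ () _ | even zero
    ... | even (suc h₀) = subst (Hi._∈Δ newPairs) (newPair-difference w (suc h₀))
      (via-newPair (ω q w) h₀ (≤-trans (m≤m+n (suc h₀) (suc h₀)) c≤n) (P-Q∈ΔT (newPair (ω q w , suc h₀))))
    ... | odd h with cut h n
    ...   | above e n+e≡h = ⊥-elim (n≮n n (≤-trans (s≤s (≤-trans (m≤m+n n e) (≤-reflexive (sym n+e≡h))))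
                                                   (≤-trans (s≤s (m≤m+n h h)) c≤n)))
    ...   | below x n≡ = subst (Hi._∈Δ newPairs)
      (trans (cong Hi.-ᴳ_ (newPair-difference w (suc x))) (cong (true ∷ true ∷ w ,_) (-ᵈ-[] 1 (begin
        suc x + suc x + suc (h + h)        ≡⟨ regroup h x ⟩
        suc (h + x) + suc (suc (h + x))    ≡⟨ cong (λ z → z + suc z) n≡ ⟨
        n + suc n                          ≡⟨ d≡n+1+n ⟨
        d                                  ≡⟨ +-identityʳ d ⟨
        1 * d                              ∎))))
      (Hi.∈Δ-negation (via-newPair (ω q w) x (s≤s (≤-trans (m≤n+m x h) (≤-reflexive (sym (suc-injective n≡)))))
        (P-Q∈ΔT (newPair (ω q w , suc x)))))
      where
      open ≡-Reasoning
      regroup : ∀ h x → suc x + suc x + suc (h + h) ≡ suc (h + x) + suc (suc (h + x))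
      regroup = solve-∀

    extend-covers : ∀ ps → (∀ g → ¬ Lo.Exceptional g → g Lo.∈Δ ps) → Hi.CoversHalf (map liftPair ps ++ newPairs)
    extend-covers ps covers (false ∷ false ∷ w) c _ _ ¬exc =
      Any.++⁺ˡ (lift-∈Δ (covers (w , [ c ]) (¬exc ∘ lift-exceptional)))
    extend-covers ps covers (true ∷ false ∷ w) (suc c₀) _ c≤n _ =
      Any.++⁺ʳ (map liftPair ps) (via-newPair w c₀ c≤n (P∈ΔT (newPair (w , suc c₀))))
    extend-covers ps covers (false ∷ true ∷ w) (suc c₀) _ c≤n _ = Any.++⁺ʳ (map liftPair ps)
      (subst (Hi._∈Δ newPairs) (cong₂ (λ v y → false ∷ true ∷ v , y) (ω³≡id q w) (-ᵈ-involutive [ suc c₀ ]))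
        (Hi.∈Δ-negation (via-newPair u c₀ c≤n (Q∈ΔT (newPair (u , suc c₀))))))
      where
      u = ω q (ω q w)
    extend-covers ps covers (true ∷ true ∷ w) c 1≤c c≤n _ = Any.++⁺ʳ (map liftPair ps) (row-11 w c 1≤c c≤n)

    length-newPairs : length newPairs ≡ 2 ^ (q * 2) * n
    length-newPairs = begin
      length newPairs                                      ≡⟨ length-map newPair pairs₀ ⟩
      length pairs₀                                        ≡⟨ length-cartesianProductWith _,_ (allVecs (q * 2)) (applyUpTo suc n) ⟩
      length (allVecs (q * 2)) * length (applyUpTo suc n)  ≡⟨ cong₂ _*_ (length-allVecs (q * 2)) (length-applyUpTo suc n) ⟩
      2 ^ (q * 2) * n                                      ∎
      where
      open ≡-Reasoning
      pairs₀ = cartesianProduct (allVecs (q * 2)) (applyUpTo suc n)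

    extend : Lo.BaseBlocks → Hi.BaseBlocks
    extend B = record
      { pairs  = map liftPair pairs ++ newPairs
      ; covers = Hi.covers-by-halves _ (extend-covers pairs covers)
      ; size   = begin
          3 * length (map liftPair pairs ++ newPairs) + 1  ≡⟨ cong (λ l → 3 * l + 1) length-pairs′ ⟩
          3 * (length pairs + p * n) + 1                   ≡⟨ regroup (length pairs) p n ⟩
          (3 * length pairs + 1) + 3 * (p * n)             ≡⟨ cong (_+ 3 * (p * n)) size ⟩
          p * n + 3 * (p * n)                              ≡⟨ collect p n ⟩
          2 * (2 * p) * n                                  ∎
      }
      where
      open Lo.BaseBlocks B
      open ≡-Reasoning
      p = 2 ^ (q * 2)
      length-pairs′ : length (map liftPair pairs ++ newPairs) ≡ length pairs + p * n
      length-pairs′ = trans (length-++ (map liftPair pairs)) (cong₂ _+_ (length-map liftPair pairs) length-newPairs)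
      regroup : ∀ l p n → 3 * (l + p * n) + 1 ≡ (3 * l + 1) + 3 * (p * n)
      regroup = solve-∀
      collect : ∀ p n → p * n + 3 * (p * n) ≡ 2 * (2 * p) * n
      collect = solve-∀

baseBlocks-d≡3 : ∀ q → Construction.Level.BaseBlocks 0 (q * 2)
baseBlocks-d≡3 zero    = record { pairs = [] ; covers = λ g ¬exc → ⊥-elim (¬exc (all-exceptional g)) ; size = refl }
  where
  open Construction.Level 0 0
  all-exceptional : ∀ g → Exceptional g
  all-exceptional ([] , zero)             = inj₁ refl
  all-exceptional ([] , suc zero)         = inj₂ (refl , inj₁ (sym ([toℕ] (suc zero))))
  all-exceptional ([] , suc (suc zero))   = inj₂ (refl , inj₂ (sym ([toℕ] (suc (suc zero)))))
baseBlocks-d≡3 (suc q) = Construction.Step.extend 0 q (baseBlocks-d≡3 q)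

-- Base blocks for m = 2

r₀ r₁ r₂ r₃ : Vec Bool 2
r₀ = false ∷ false ∷ []
r₁ = true  ∷ false ∷ []
r₂ = false ∷ true  ∷ []
r₃ = true  ∷ true  ∷ []

module BlocksAt2 (k′ : ℕ) where

  block₁ block₂ block₃ block₄ : ℕ → PairRep 2
  block₁ j = rep r₁ (suc k′ + j)          r₀ (3 + suc k′ * 4 + j * 2)
  block₂ j = rep r₀ (3 + suc k′ * 3 + j)  r₂ (4 + suc k′ * 3 + j * 2)
  block₃ j = rep r₁ (1 + j)               r₂ (3 + suc k′ * 3 + j * 2)
  block₄ j = rep r₃ (1 + j)               r₀ (4 + suc k′ * 4 + j * 2)

  block₅ block₆ block₇ block₈ block₉ : PairRep 2
  block₅ = rep r₂ (suc k′)     r₀ (1 + suc k′ * 6)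
  block₆ = rep r₁ (1 + k′ * 2) r₀ (2 + suc k′ * 6)
  block₇ = rep r₂ (2 + k′)     r₃ (2 + suc k′ * 4)
  block₈ = rep r₃ (suc k′)     r₀ (2 + suc k′ * 3)
  block₉ = rep r₃ (2 + k′)     r₁ (2 + suc k′ * 4)

  family : ℕ → List (PairRep 2)
  family j = block₁ j ∷ block₂ j ∷ block₃ j ∷ block₄ j ∷ []

  blocks : List (PairRep 2)
  blocks = concatMap family (upTo k′) ++ block₅ ∷ block₆ ∷ block₇ ∷ block₈ ∷ block₉ ∷ []

  length-blocks : length blocks ≡ 4 * k′ + 5
  length-blocks = trans (length-++ (concatMap family (upTo k′)))
    (cong (_+ 5) (trans (length-families (upTo k′)) (cong (4 *_) (length-upTo k′))))
    where
    length-families : ∀ js → length (concatMap family js) ≡ 4 * length js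
    length-families []       = refl
    length-families (j ∷ js) = trans (cong (4 +_) (length-families js)) (sym (*-suc 4 (length js)))

open BlocksAt2 using (block₁; block₂; block₃; block₄; block₅; block₆; block₇; block₈; block₉; blocks)

module _ (k′ : ℕ) where

  open Group 2 (3 + suc k′ * 6) using (IsDifference)

  -- A data type for the same reason as Difference.
  data BaseDifference (r : Vec Bool 2) (c : ℕ) : Set where
    in-block₁ : ∀ {j} → j < k′ → IsDifference (block₁ k′ j) r c → BaseDifference r c
    in-block₂ : ∀ {j} → j < k′ → IsDifference (block₂ k′ j) r c → BaseDifference r c
    in-block₃ : ∀ {j} → j < k′ → IsDifference (block₃ k′ j) r c → BaseDifference r c
    in-block₄ : ∀ {j} → j < k′ → IsDifference (block₄ k′ j) r c → BaseDifference r c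
    in-block₅ : IsDifference (block₅ k′) r c → BaseDifference r c
    in-block₆ : IsDifference (block₆ k′) r c → BaseDifference r c
    in-block₇ : IsDifference (block₇ k′) r c → BaseDifference r c
    in-block₈ : IsDifference (block₈ k′) r c → BaseDifference r c
    in-block₉ : IsDifference (block₉ k′) r c → BaseDifference r c

open Group using (≡P; ≡-P; ≡-Q; ≡P-Q; ≡Q-P)

<-left : ∀ a b → a < suc (a + b)
<-left a b = s≤s (m≤m+n a b)

<-right : ∀ a b → b < suc (a + b)
<-right a b = s≤s (m≤n+m b a)

beyond : ∀ {c b} → c ≤ b → ∀ w → c ≡ b + suc w → ⊥
beyond {b = b} c≤b w refl = m+1+n≰m b c≤b

cover-row₁ : ∀ k′ c₀ → suc c₀ ≤ 1 + suc k′ * 3 → BaseDifference k′ r₁ (suc c₀)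
cover-row₁ k′ c₀ c≤n with cut c₀ k′
... | below x refl = in-block₃ (<-left c₀ x) (≡P refl refl)
... | above e refl with cut e k′
...   | below x refl = in-block₁ (<-left e x) (≡P refl refl)
...   | above 0 refl = in-block₆ (≡P refl (solve (List ℕ ∋ k′ ∷ [])))
...   | above 1 refl = in-block₆ (≡P-Q refl 1 0 (solve (List ℕ ∋ k′ ∷ [])))
...   | above 2 refl = in-block₉ (≡-Q refl (solve (List ℕ ∋ k′ ∷ [])))
...   | above (suc (suc (suc e₃))) refl with cut e₃ k′
...     | below x refl = in-block₁ (<-right e₃ x) (≡P-Q refl 1 0 (solve (List ℕ ∋ e₃ ∷ x ∷ [])))
...     | above 0 refl = in-block₇ (≡Q-P refl 0 0 (solve (List ℕ ∋ k′ ∷ [])))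
...     | above (suc z) refl = ⊥-elim (beyond c≤n z (solve (List ℕ ∋ k′ ∷ z ∷ [])))

cover-row₂ : ∀ k′ c₀ → suc c₀ ≤ 1 + suc k′ * 3 → BaseDifference k′ r₂ (suc c₀)
cover-row₂ k′ c₀ c≤n with cut c₀ k′
... | below x refl = in-block₂ (<-left c₀ x) (≡Q-P refl 0 0 (solve (List ℕ ∋ c₀ ∷ x ∷ [])))
... | above 0 refl = in-block₅ (≡P refl (solve (List ℕ ∋ k′ ∷ [])))
... | above 1 refl = in-block₇ (≡P refl (solve (List ℕ ∋ k′ ∷ [])))
... | above 2 refl = in-block₅ (≡P-Q refl 1 0 (solve (List ℕ ∋ k′ ∷ [])))
... | above (suc (suc (suc e))) refl with parity e
...   | even h with cut h k′
...     | below x refl = in-block₂ (<-right h x) (≡-Q refl (solve (List ℕ ∋ h ∷ x ∷ [])))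
...     | above 0 refl = in-block₉ (≡Q-P refl 0 0 (solve (List ℕ ∋ k′ ∷ [])))
...     | above (suc z) refl = ⊥-elim (beyond c≤n (suc (z * 2)) (solve (List ℕ ∋ k′ ∷ z ∷ [])))
cover-row₂ k′ c₀ c≤n | above (suc (suc (suc e))) refl | odd h with cut h k′
...     | below x refl = in-block₃ (<-right h x) (≡-Q refl (solve (List ℕ ∋ h ∷ x ∷ [])))
...     | above z refl = ⊥-elim (beyond c≤n (z * 2) (solve (List ℕ ∋ k′ ∷ z ∷ [])))

cover-row₃ : ∀ k′ c₀ → suc c₀ ≤ 1 + suc k′ * 3 → BaseDifference k′ r₃ (suc c₀)
cover-row₃ k′ c₀ c≤n with cut c₀ k′
... | below x refl = in-block₄ (<-left c₀ x) (≡P refl refl)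
... | above 0 refl = in-block₈ (≡P refl (solve (List ℕ ∋ k′ ∷ [])))
... | above 1 refl = in-block₉ (≡P refl (solve (List ℕ ∋ k′ ∷ [])))
... | above (suc (suc e)) refl with cut e k′
...   | below x refl = in-block₄ (<-right e x) (≡P-Q refl 1 0 (solve (List ℕ ∋ e ∷ x ∷ [])))
...   | above 0 refl = in-block₇ (≡-Q refl (solve (List ℕ ∋ k′ ∷ [])))
...   | above 1 refl = in-block₈ (≡Q-P refl 0 0 (solve (List ℕ ∋ k′ ∷ [])))
...   | above (suc (suc e′)) refl with cut e′ k′
...     | below x refl = in-block₃ (<-right e′ x) (≡P-Q refl 1 0 (solve (List ℕ ∋ e′ ∷ x ∷ [])))
...     | above z refl = ⊥-elim (beyond c≤n z (solve (List ℕ ∋ k′ ∷ z ∷ [])))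

cover-row₀-below-t : ∀ k′ c → 1 ≤ c → suc c ≤ 1 + suc k′ * 2 → BaseDifference k′ r₀ c
cover-row₀-below-t k′ c 1≤c c<t with parity c
cover-row₀-below-t k′ _ () c<t | even zero
... | even 1 = in-block₅ (≡-Q refl (solve (List ℕ ∋ k′ ∷ [])))
... | even (suc (suc h)) with cut h k′
...   | below x refl = in-block₁ (<-right h x) (≡-Q refl (solve (List ℕ ∋ h ∷ x ∷ [])))
...   | above z refl = ⊥-elim (beyond c<t (suc (z * 2)) (solve (List ℕ ∋ k′ ∷ z ∷ [])))
cover-row₀-below-t k′ _ 1≤c c<t | odd zero = in-block₆ (≡-Q refl (solve (List ℕ ∋ k′ ∷ [])))
cover-row₀-below-t k′ _ 1≤c c<t | odd (suc h) with cut h k′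
...   | below x refl = in-block₄ (<-right h x) (≡-Q refl (solve (List ℕ ∋ h ∷ x ∷ [])))
...   | above z refl = ⊥-elim (beyond c<t (z * 2) (solve (List ℕ ∋ k′ ∷ z ∷ [])))

cover-row₀ : ∀ k′ c → 1 ≤ c → c ≤ 1 + suc k′ * 3 → c ≢ 1 + suc k′ * 2 → BaseDifference k′ r₀ c
cover-row₀ k′ c 1≤c c≤n c≢t with cut c (1 + suc k′ * 2)
... | below x t≡ = cover-row₀-below-t k′ c 1≤c (subst (suc c ≤_) (sym t≡) (s≤s (m≤m+n c x)))
... | above 0 c≡t+0 = ⊥-elim (c≢t (trans c≡t+0 (+-identityʳ _)))
... | above (suc w) refl with cut w k′
...   | below x refl = in-block₂ (<-right w x) (≡-P refl (solve (List ℕ ∋ w ∷ x ∷ [])))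
...   | above 0 refl = in-block₈ (≡-Q refl (solve (List ℕ ∋ k′ ∷ [])))
...   | above (suc z) refl = ⊥-elim (beyond c≤n z (solve (List ℕ ∋ k′ ∷ z ∷ [])))

module _ {k′ : ℕ} where

  open Group 2 (3 + suc k′ * 6)

  private
    via : ∀ {p r c} → p ∈ blocks k′ → IsDifference p r c → (r , [ c ]) ∈Δ map pairOf (blocks k′)
    via {p} p∈ = Any.map⁺ ∘ lose p∈ ∘ isDifference⇒∈ΔT p

    in-family : ∀ {j p} → j < k′ → p ∈ BlocksAt2.family k′ j → p ∈ blocks k′
    in-family j<k′ p∈ = ∈-++⁺ˡ (∈-concat⁺′ p∈ (∈-map⁺ (BlocksAt2.family k′) (∈-upTo⁺ j<k′)))

    in-sporadic : ∀ {p} → p ∈ block₅ k′ ∷ block₆ k′ ∷ block₇ k′ ∷ block₈ k′ ∷ block₉ k′ ∷ [] →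
      p ∈ blocks k′
    in-sporadic = ∈-++⁺ʳ (concatMap (BlocksAt2.family k′) (upTo k′))

  baseDifference⇒∈Δ : ∀ {r c} → BaseDifference k′ r c → (r , [ c ]) ∈Δ map pairOf (blocks k′)
  baseDifference⇒∈Δ (in-block₁ j<k′ h) = via (in-family j<k′ (here refl)) h
  baseDifference⇒∈Δ (in-block₂ j<k′ h) = via (in-family j<k′ (there (here refl))) h
  baseDifference⇒∈Δ (in-block₃ j<k′ h) = via (in-family j<k′ (there (there (here refl)))) h
  baseDifference⇒∈Δ (in-block₄ j<k′ h) = via (in-family j<k′ (there (there (there (here refl))))) h
  baseDifference⇒∈Δ (in-block₅ h)      = via (in-sporadic (here refl)) h
  baseDifference⇒∈Δ (in-block₆ h)      = via (in-sporadic (there (here refl))) h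
  baseDifference⇒∈Δ (in-block₇ h)      = via (in-sporadic (there (there (here refl)))) h
  baseDifference⇒∈Δ (in-block₈ h)      = via (in-sporadic (there (there (there (here refl))))) h
  baseDifference⇒∈Δ (in-block₉ h)      = via (in-sporadic (there (there (there (there (here refl)))))) h

baseBlocks-m≡2 : ∀ k′ → Construction.Level.BaseBlocks (suc k′) 2
baseBlocks-m≡2 k′ = record
  { pairs  = map pairOf (blocks k′)
  ; covers = covers-by-halves _ half
  ; size   = trans (cong (λ l → 3 * l + 1) (trans (length-map pairOf (blocks k′)) (BlocksAt2.length-blocks k′)))
                   block-count
  }
  where
  open Construction.Level (suc k′) 2
  block-count : 3 * (4 * k′ + 5) + 1 ≡ 2 ^ 2 * (1 + suc k′ * 3)
  block-count = solve (List ℕ ∋ k′ ∷ [])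
  half : CoversHalf (map pairOf (blocks k′))
  half (false ∷ false ∷ []) c        1≤c c≤n ¬exc = baseDifference⇒∈Δ
    (cover-row₀ k′ c 1≤c c≤n (λ c≡t → ¬exc (inj₂ (refl , inj₁ (cong [_] c≡t)))))
  half (true  ∷ false ∷ []) (suc c₀) _   c≤n _    = baseDifference⇒∈Δ (cover-row₁ k′ c₀ c≤n)
  half (false ∷ true  ∷ []) (suc c₀) _   c≤n _    = baseDifference⇒∈Δ (cover-row₂ k′ c₀ c≤n)
  half (true  ∷ true  ∷ []) (suc c₀) _   c≤n _    = baseDifference⇒∈Δ (cover-row₃ k′ c₀ c≤n)

-- For d > 3 the recursion starts at m = 2: at m = 0 it would need a (ℤ_d, {3¹}, 3, 1)-difference
-- family, and there is none for d = 9.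
baseBlocks : ∀ k q → Construction.Level.BaseBlocks k (suc q * 2)
baseBlocks zero     q       = baseBlocks-d≡3 (suc q)
baseBlocks (suc k′) zero    = baseBlocks-m≡2 k′
baseBlocks (suc k′) (suc q) = Construction.Step.extend (suc k′) (suc q) (baseBlocks (suc k′) q)

HasDifferenceFamily : (m d : ℕ) .{{_ : NonZero d}} → Set
HasDifferenceFamily m d = Σ (List (Subgroup m d)) λ Σs →
  IsPartialSpread m d Σs × HasType-2-3 m d (2 ^ m ∸ 1) Σs × Σ (List (Triple m d)) (IsDifferenceFamily m d Σs)

hasDifferenceFamily : ∀ k q → HasDifferenceFamily (suc q * 2) (3 + k * 6)
hasDifferenceFamily k q =
  spread , spread-isPartialSpread , spread-hasType , map triple (BaseBlocks.pairs B) , differenceFamily B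
  where
  open Construction.Level k (suc q * 2)
  B : BaseBlocks
  B = baseBlocks k q

-- The construction works for every even m ≥ 2; the hypothesis 4 ≤ m only serves to exclude m = 0.
proposition3p9 : (m d : ℕ) → .{{_ : NonZero d}} → 2 ∣ m → 4 ≤ m → d % 6 ≡ 3 →
    Σ (List (Subgroup m d)) λ Σs →
      IsPartialSpread m d Σs × HasType-2-3 m d (2 ^ m ∸ 1) Σs ×
      Σ (List (Triple m d)) λ 𝒯 → IsDifferenceFamily m d Σs 𝒯
proposition3p9 m d (divides zero refl) () _
proposition3p9 m d (divides (suc q) refl) _ d%6≡3 =
  at (d / 6) (trans (m≡m%n+[m/n]*n d 6) (cong (_+ d / 6 * 6) d%6≡3))
  where
  at : ∀ {d} .{{_ : NonZero d}} k → d ≡ 3 + k * 6 → HasDifferenceFamily (suc q * 2) d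
  at k refl = hasDifferenceFamily k q
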